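{- For any valued field $K$ and $d \geq 1$, the family $\operatorname{Conv}_{K^d}$ of convex subsets of $K^d$ has dual VC-dimension $d$.
   Context: $K$ is a field with a valuation $\nu$ and valuation ring $\mathcal{O} = \{x:\nu(x)\ge0\}$. A set $X \subseteq K^d$ is convex if for all $n\ge1$, $x_1,\ldots,x_n\in X$ and $\alpha_1,\ldots,\alpha_n\in\mathcal{O}$ with $\sum\alpha_i=1$, $\sum\alpha_i x_i\in X$. For a family $\mathcal{F}$ of subsets of a set $X$, the dual VC-dimension of $\mathcal{F}$ is the largest $k \in \mathbb{N}$ (or $\infty$ if there is none) such that there are $S_1,\ldots,S_k \in \mathcal{F}$ generating a Boolean algebra with $2^k$ atoms, i.e.\ for every $I \subseteq [k]$ the set $\bigcap_{i \in I} S_i \cap \bigcap_{i \in [k]\setminus I}(X \setminus S_i)$ is nonempty (equivalently, these $2^k$ sets are pairwise distinct). Equivalently, it is the VC-dimension of the dual family $\{\{A \in \mathcal{F} : x \in A\} : x \in X\}$. -}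

module Defs where

open import Level using (Level; _⊔_; suc)
open import Data.Nat as ℕ using (ℕ)
open import Data.Fin using (Fin)
open import Data.Bool using (Bool; true)
open import Data.Unit.Polymorphic using (⊤)
open import Data.Empty.Polymorphic using (⊥)
open import Data.Sum using (_⊎_)
open import Data.Product using (Σ; ∃; _×_)
open import Relation.Nullary using (¬_)
open import Relation.Binary.PropositionalEquality using (_≡_)
open import Function.Bundles using (_⇔_)
open import Algebra.Bundles using (CommutativeRing; AbelianGroup)
open import Relation.Binary.Structures using (IsTotalOrder)
import Algebra.Definitions.RawMonoid as RawMonoidDefs

record OrderedAbelianGroup (g ℓ ℓ≤ : Level) : Set (suc (g ⊔ ℓ ⊔ ℓ≤)) where
  field
    abGroup : AbelianGroup g ℓ
  open AbelianGroup abGroup public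
  field
    _≤_         : Carrier → Carrier → Set ℓ≤
    isTotalOrder : IsTotalOrder _≈_ _≤_
    ∙-mono-≤    : ∀ {a b} c → a ≤ b → (a ∙ c) ≤ (b ∙ c)

module Extended {g ℓ ℓ≤} (Γ : OrderedAbelianGroup g ℓ ℓ≤) where
  open OrderedAbelianGroup Γ

  data Γ∞ : Set g where
    fin : Carrier → Γ∞
    ∞   : Γ∞

  _≈∞_ : Γ∞ → Γ∞ → Set ℓ
  fin a ≈∞ fin b = a ≈ b
  fin _ ≈∞ ∞     = ⊥
  ∞     ≈∞ fin _ = ⊥
  ∞     ≈∞ ∞     = ⊤

  _≤∞_ : Γ∞ → Γ∞ → Set ℓ≤
  fin a ≤∞ fin b = a ≤ b
  _     ≤∞ ∞     = ⊤
  ∞     ≤∞ fin _ = ⊥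

  _+∞_ : Γ∞ → Γ∞ → Γ∞
  fin a +∞ fin b = fin (a ∙ b)
  _     +∞ _     = ∞

  0∞ : Γ∞
  0∞ = fin ε

record IsFieldCR {c ℓ} (R : CommutativeRing c ℓ) : Set (c ⊔ ℓ) where
  open CommutativeRing R
  field
    1≉0     : ¬ (1# ≈ 0#)
    inverse : ∀ x → ¬ (x ≈ 0#) → ∃ λ y → (x * y) ≈ 1#

record ValuedField (c ℓ g ℓg ℓ≤ : Level) : Set (suc (c ⊔ ℓ ⊔ g ⊔ ℓg ⊔ ℓ≤)) where
  field
    cring   : CommutativeRing c ℓ
    isField : IsFieldCR cring
    Γ       : OrderedAbelianGroup g ℓg ℓ≤
  open CommutativeRing cring public
  open Extended Γ public
  field
    ν       : Carrier → Γ∞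
    ν-cong  : ∀ {x y} → x ≈ y → ν x ≈∞ ν y
    ν-∞     : ∀ x → (ν x ≈∞ ∞) ⇔ (x ≈ 0#)
    ν-mult  : ∀ x y → ν (x * y) ≈∞ (ν x +∞ ν y)
    ν-ultra : ∀ x y → (ν x ≤∞ ν (x + y)) ⊎ (ν y ≤∞ ν (x + y))

  _∈𝒪 : Carrier → Set ℓ≤
  x ∈𝒪 = 0∞ ≤∞ ν x

module _ {c ℓ g ℓg ℓ≤} (K : ValuedField c ℓ g ℓg ℓ≤) where
  open ValuedField K
  open RawMonoidDefs +-rawMonoid using (sum)

  Point : ℕ → Set c
  Point d = Fin d → Carrier

  _≋_ : ∀ {d} → Point d → Point d → Set ℓ
  x ≋ y = ∀ j → x j ≈ y j

  SubsetLevel : Level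
  SubsetLevel = c ⊔ ℓ ⊔ g ⊔ ℓg ⊔ ℓ≤

  record Subset (d : ℕ) : Set (suc SubsetLevel) where
    field
      _∋_   : Point d → Set SubsetLevel
      resp  : ∀ {x y} → x ≋ y → _∋_ x → _∋_ y
  open Subset public

  combination : ∀ {d n} → (Fin n → Carrier) → (Fin n → Point d) → Point d
  combination α x j = sum (λ i → α i * x i j)

  IsConvex : ∀ {d} → Subset d → Set (c ⊔ ℓ ⊔ SubsetLevel ⊔ ℓ≤)
  IsConvex {d} X =
    ∀ (n : ℕ) → 1 ℕ.≤ n →
    (x : Fin n → Point d) (α : Fin n → Carrier) →
    (∀ i → X ∋ x i) → (∀ i → α i ∈𝒪) → sum α ≈ 1# →
    X ∋ combination α x

  -- S_1,…,S_k generate a Boolean algebra with 2^k atoms: every atom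
  -- ⋂_{i∈I} S_i ∩ ⋂_{i∉I} (K^d ∖ S_i) is nonempty.
  AllAtomsNonempty : ∀ {d k} → (Fin k → Subset d) → Set (c ⊔ SubsetLevel)
  AllAtomsNonempty {d} {k} S =
    (I : Fin k → Bool) → Σ (Point d) λ x →
      ∀ i → (I i ≡ true → S i ∋ x) × (¬ (I i ≡ true) → ¬ (S i ∋ x))

  ConvHasDualVCDim : (d m : ℕ) → Set (suc SubsetLevel)
  ConvHasDualVCDim d m =
    (Σ (Fin m → Subset d) λ S → (∀ i → IsConvex (S i)) × AllAtomsNonempty S)
    × (∀ k → m ℕ.< k → (S : Fin k → Subset d) → (∀ i → IsConvex (S i)) →
         ¬ AllAtomsNonempty S)

module Submission where

-- The d coordinate hyperplanes x i = 0 are convex and realise all 2^d atoms (take 0/1-points).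
-- Conversely, suppose d + 1 convex sets S i have all atoms nonempty: pick q in every S i and
-- p i in all S j except S i. Over the valuation ring 𝒪, Gaussian elimination with pivots of
-- least valuation gives an 𝒪-linear relation ∑ λ i (p i - q) = 0 with some λ i = 1, which
-- exhibits p i as an 𝒪-convex combination of q and the p j (j ≠ i), all of which lie in the
-- convex set S i, contradicting p i ∉ S i.

open import Defs
open import Level using (Level; _⊔_)
open import Data.Nat as ℕ using (ℕ; zero; suc; _≤_)
open import Data.Nat.Properties using (n<1+n)
open import Data.Fin as Fin using (Fin; zero; suc; punchIn; punchOut; inject≤)
open import Data.Fin.Properties using (punchInᵢ≢i; punchIn-punchOut; inject≤-injective)
open import Data.Vec.Functional using (insertAt; removeAt)
open import Data.Vec.Functional.Properties using (insertAt-lookup; insertAt-punchIn; removeAt-insertAt)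
open import Data.Bool using (Bool; true; false; not; if_then_else_)
open import Data.Product using (∃; _×_; _,_; proj₁; proj₂)
open import Data.Sum using (_⊎_; inj₁; inj₂)
open import Data.Empty using (⊥-elim)
open import Data.Unit.Polymorphic using (tt)
open import Function using (_∘_; Equivalence)
open import Relation.Nullary using (¬_; Dec; does; yes; no)
open import Relation.Nullary.Decidable using (dec-true; dec-false)
open import Relation.Binary.Bundles using (TotalPreorder)
open import Algebra.Bundles using (CommutativeRing)
open import Relation.Binary.Structures using (IsTotalOrder)
open import Relation.Binary.PropositionalEquality as ≡ using (_≡_; _≢_)
import Algebra.Properties.Group as GroupProperties
import Algebra.Properties.Ring as RingProperties
import Algebra.Properties.Semiring.Sum as SemiringSum
import Relation.Binary.Reasoning.Setoid as SetoidReasoning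
import Relation.Binary.Reasoning.Preorder as PreorderReasoning

module ExtendedOrder {g ℓ ℓ≤} (Γ : OrderedAbelianGroup g ℓ ℓ≤) where
  open OrderedAbelianGroup Γ
  open Extended Γ
  private module ≤ = IsTotalOrder isTotalOrder

  ≈∞-refl : ∀ {a} → a ≈∞ a
  ≈∞-refl {fin a} = refl
  ≈∞-refl {∞}     = tt

  ≈∞-sym : ∀ {a b} → a ≈∞ b → b ≈∞ a
  ≈∞-sym {fin a} {fin b} a≈b = sym a≈b
  ≈∞-sym {∞}     {∞}     _   = tt

  ≈∞-trans : ∀ {a b e} → a ≈∞ b → b ≈∞ e → a ≈∞ e
  ≈∞-trans {fin a} {fin b} {fin e} a≈b b≈e = trans a≈b b≈e
  ≈∞-trans {∞}     {∞}     {∞}     _   _   = tt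

  ≈∞⇒≤∞ : ∀ {a b} → a ≈∞ b → a ≤∞ b
  ≈∞⇒≤∞ {fin a} {fin b} a≈b = ≤.reflexive a≈b
  ≈∞⇒≤∞ {fin a} {∞}     _   = tt
  ≈∞⇒≤∞ {∞}     {∞}     _   = tt

  ≤∞-trans : ∀ {a b e} → a ≤∞ b → b ≤∞ e → a ≤∞ e
  ≤∞-trans {fin a} {fin b} {fin e} a≤b b≤e = ≤.trans a≤b b≤e
  ≤∞-trans {fin a} {_}     {∞}     _   _   = tt
  ≤∞-trans {∞}     {∞}     {∞}     _   _   = tt

  ≤∞-total : ∀ a b → (a ≤∞ b) ⊎ (b ≤∞ a)
  ≤∞-total (fin a) (fin b) = ≤.total a b
  ≤∞-total (fin a) ∞       = inj₁ tt
  ≤∞-total ∞       ∞       = inj₁ tt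
  ≤∞-total ∞       (fin b) = inj₂ tt

  ≤∞-totalPreorder : TotalPreorder g ℓ ℓ≤
  ≤∞-totalPreorder = record
    { _≈_ = _≈∞_
    ; _≲_ = _≤∞_
    ; isTotalPreorder = record
      { isPreorder = record
        { isEquivalence = record
          { refl  = λ {a} → ≈∞-refl {a}
          ; sym   = λ {a} {b} → ≈∞-sym {a} {b}
          ; trans = λ {a} {b} {e} → ≈∞-trans {a} {b} {e}
          }
        ; reflexive     = λ {a} {b} → ≈∞⇒≤∞ {a} {b}
        ; trans         = λ {a} {b} {e} → ≤∞-trans {a} {b} {e}
        }
      ; total = ≤∞-total
      }
    }

  ∞≤∞⇒≈∞ : ∀ {a} → ∞ ≤∞ a → a ≈∞ ∞
  ∞≤∞⇒≈∞ {∞} _ = tt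

  +∞-monoˡ-≤∞ : ∀ {a b} e → a ≤∞ b → (a +∞ e) ≤∞ (b +∞ e)
  +∞-monoˡ-≤∞ {fin a} {fin b} (fin e) a≤b = ∙-mono-≤ e a≤b
  +∞-monoˡ-≤∞ {fin a} {∞}     (fin e) _   = tt
  +∞-monoˡ-≤∞ {fin a} {fin b} ∞       _   = tt
  +∞-monoˡ-≤∞ {fin a} {∞}     ∞       _   = tt
  +∞-monoˡ-≤∞ {∞}     {∞}     _       _   = tt

  0∞≤∞-+∞ : ∀ {a b} → 0∞ ≤∞ a → 0∞ ≤∞ b → 0∞ ≤∞ (a +∞ b)
  0∞≤∞-+∞ {fin a} {fin b} 0≤a 0≤b =
    ≤.trans 0≤b (≤.trans (≤.reflexive (sym (identityˡ b))) (∙-mono-≤ b 0≤a))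
  0∞≤∞-+∞ {fin a} {∞}     _   _   = tt
  0∞≤∞-+∞ {∞}     {_}     _   _   = tt

  idempotent⇒≈0∞ : ∀ {a} → a ≈∞ (a +∞ a) → ¬ (a ≈∞ ∞) → a ≈∞ 0∞
  idempotent⇒≈0∞ {fin a} a≈a+a _   = GroupProperties.identityˡ-unique group a a (sym a≈a+a)
  idempotent⇒≈0∞ {∞}     _     a≉∞ = ⊥-elim (a≉∞ tt)

  self-+∞≈0∞⇒0∞≤∞ : ∀ {a} → (a +∞ a) ≈∞ 0∞ → 0∞ ≤∞ a
  self-+∞≈0∞⇒0∞≤∞ {∞}     _ = tt
  self-+∞≈0∞⇒0∞≤∞ {fin a} a+a≈0 with ≤.total ε a
  ... | inj₁ 0≤a = 0≤a
  ... | inj₂ a≤0 =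
    ≤.trans (≤.reflexive (sym a+a≈0)) (≤.trans (∙-mono-≤ a a≤0) (≤.reflexive (identityˡ a)))

module _ {a ℓ₁ ℓ₂} (P : TotalPreorder a ℓ₁ ℓ₂) where
  open TotalPreorder P

  argmin : ∀ {m} (f : Fin (suc m) → Carrier) → ∃ λ k → ∀ j → f k ≲ f j
  argmin {zero}  f = zero , λ { zero → refl }
  argmin {suc m} f with argmin (f ∘ suc)
  ... | k , fk≤ with total (f zero) (f (suc k))
  ...   | inj₁ f0≤fk = zero  , λ { zero → refl ; (suc j) → trans f0≤fk (fk≤ j) }
  ...   | inj₂ fk≤f0 = suc k , λ { zero → fk≤f0 ; (suc j) → fk≤ j }

insertAt-∀ : ∀ {a p} {A : Set a} (P : A → Set p) {n} (xs : Fin n → A) (i : Fin (suc n)) {x : A} →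
  P x → (∀ j → P (xs j)) → ∀ j → P (insertAt xs i x j)
insertAt-∀ P xs i {x} Px Pxs j with i Fin.≟ j
... | yes ≡.refl = ≡.subst P (≡.sym (insertAt-lookup xs i x)) Px
... | no i≢j     = ≡.subst P xs[j′]≡ (Pxs (punchOut i≢j))
  where
  xs[j′]≡ : xs (punchOut i≢j) ≡ insertAt xs i x j
  xs[j′]≡ = ≡.trans (≡.sym (insertAt-punchIn xs i x (punchOut i≢j)))
                    (≡.cong (insertAt xs i x) (punchIn-punchOut i≢j))

module RingSums {c ℓ} (R : CommutativeRing c ℓ) where
  open CommutativeRing R hiding (zero)
  open SemiringSum semiring
  private module P = RingProperties ring

  sum-zero : ∀ {n} (f : Fin n → Carrier) → (∀ j → f j ≈ 0#) → sum f ≈ 0#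
  sum-zero {n} f f≈0 = trans (sum-cong-≋ f≈0) (sum-replicate-zero n)

  sum-neg : ∀ {n} (f : Fin n → Carrier) → sum (λ j → - f j) ≈ - sum f
  sum-neg {zero}  f = sym P.-0#≈0#
  sum-neg {suc n} f = trans (+-congˡ (sum-neg (f ∘ suc))) (P.-‿+-comm (f zero) (sum (f ∘ suc)))

  sum-*-sub : ∀ {n} (μ a b : Fin n → Carrier) →
    sum (λ j → μ j * (a j - b j)) ≈ sum (λ j → μ j * a j) - sum (λ j → μ j * b j)
  sum-*-sub μ a b = begin
    sum (λ j → μ j * (a j - b j))
      ≈⟨ sum-cong-≋ (λ j → P.x[y-z]≈xy-xz (μ j) (a j) (b j)) ⟩
    sum (λ j → μ j * a j - μ j * b j)
      ≈⟨ ∑-distrib-+ (λ j → μ j * a j) _ ⟩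
    sum (λ j → μ j * a j) + sum (λ j → - (μ j * b j))
      ≈⟨ +-congˡ (sum-neg (λ j → μ j * b j)) ⟩
    sum (λ j → μ j * a j) - sum (λ j → μ j * b j) ∎
    where open SetoidReasoning setoid

  sum-*-*ʳ : ∀ {n} (μ e : Fin n → Carrier) b →
    sum (λ j → μ j * (e j * b)) ≈ sum (λ j → μ j * e j) * b
  sum-*-*ʳ μ e b =
    trans (sum-cong-≋ (λ j → sym (*-assoc (μ j) (e j) b))) (sym (*-distribʳ-sum b (λ j → μ j * e j)))

  sum-insertAt : ∀ {n} (α : Fin n → Carrier) i a → sum (insertAt α i a) ≈ a + sum α
  sum-insertAt α i a = begin
    sum (insertAt α i a)                                   ≈⟨ sum-remove {i = i} (insertAt α i a) ⟩
    insertAt α i a i + sum (removeAt (insertAt α i a) i)   ≡⟨ ≡.cong₂ _+_ (insertAt-lookup α i a)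
                                                               (sum-cong-≗ (removeAt-insertAt α i a)) ⟩
    a + sum α                                              ∎
    where open SetoidReasoning setoid

  sum-insertAt-* : ∀ {n} (α : Fin n → Carrier) (x : Fin (suc n) → Carrier) i a →
    sum (λ j → insertAt α i a j * x j) ≈ a * x i + sum (λ j → α j * x (punchIn i j))
  sum-insertAt-* α x i a = begin
    sum (λ j → insertAt α i a j * x j)
      ≈⟨ sum-remove {i = i} (λ j → insertAt α i a j * x j) ⟩
    insertAt α i a i * x i + sum (λ j → insertAt α i a (punchIn i j) * x (punchIn i j))
      ≡⟨ ≡.cong₂ (λ u v → u * x i + v) (insertAt-lookup α i a)
                 (sum-cong-≗ (λ j → ≡.cong (_* x (punchIn i j)) (insertAt-punchIn α i a j))) ⟩
    a * x i + sum (λ j → α j * x (punchIn i j)) ∎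
    where open SetoidReasoning setoid

module ValuationRing {c ℓ g ℓg ℓ≤} (K : ValuedField c ℓ g ℓg ℓ≤) where
  open ValuedField K hiding (zero)
  open ExtendedOrder Γ
  open SemiringSum semiring using (sum)
  open TotalPreorder ≤∞-totalPreorder using (preorder)
  private
    module ν-Reasoning = PreorderReasoning preorder
    module R = RingProperties ring

  ν-1# : ν 1# ≈∞ 0∞
  ν-1# = idempotent⇒≈0∞ {ν 1#} ν1≈ν1+ν1 (IsFieldCR.1≉0 isField ∘ Equivalence.to (ν-∞ 1#))
    where
    ν1≈ν1+ν1 : ν 1# ≈∞ (ν 1# +∞ ν 1#)
    ν1≈ν1+ν1 = begin-equality
      ν 1#            ≈⟨ ν-cong (sym (*-identityˡ 1#)) ⟩
      ν (1# * 1#)     ≈⟨ ν-mult 1# 1# ⟩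
      ν 1# +∞ ν 1#    ∎
      where open ν-Reasoning

  ∈𝒪-resp-≈ : ∀ {x y} → x ≈ y → x ∈𝒪 → y ∈𝒪
  ∈𝒪-resp-≈ {x} {y} x≈y 0≤νx = begin
    0∞   ≲⟨ 0≤νx ⟩
    ν x  ≈⟨ ν-cong x≈y ⟩
    ν y  ∎
    where open ν-Reasoning

  0#∈𝒪 : 0# ∈𝒪
  0#∈𝒪 = begin
    0∞    ≲⟨ tt ⟩
    ∞     ≈⟨ Equivalence.from (ν-∞ 0#) refl ⟨
    ν 0#  ∎
    where open ν-Reasoning

  1#∈𝒪 : 1# ∈𝒪
  1#∈𝒪 = ≈∞⇒≤∞ {0∞} {ν 1#} (≈∞-sym {ν 1#} {0∞} ν-1#)

  *-∈𝒪 : ∀ {x y} → x ∈𝒪 → y ∈𝒪 → (x * y) ∈𝒪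
  *-∈𝒪 {x} {y} 0≤νx 0≤νy = begin
    0∞          ≲⟨ 0∞≤∞-+∞ {ν x} {ν y} 0≤νx 0≤νy ⟩
    ν x +∞ ν y  ≈⟨ ν-mult x y ⟨
    ν (x * y)   ∎
    where open ν-Reasoning

  +-∈𝒪 : ∀ {x y} → x ∈𝒪 → y ∈𝒪 → (x + y) ∈𝒪
  +-∈𝒪 {x} {y} 0≤νx 0≤νy with ν-ultra x y
  ... | inj₁ νx≤ = ≤∞-trans {0∞} {ν x} {ν (x + y)} 0≤νx νx≤
  ... | inj₂ νy≤ = ≤∞-trans {0∞} {ν y} {ν (x + y)} 0≤νy νy≤

  -1#∈𝒪 : (- 1#) ∈𝒪
  -1#∈𝒪 = self-+∞≈0∞⇒0∞≤∞ {ν (- 1#)} (begin-equality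
    ν (- 1#) +∞ ν (- 1#)  ≈⟨ ν-mult (- 1#) (- 1#) ⟨
    ν (- 1# * - 1#)       ≈⟨ ν-cong (trans (R.-1*x≈-x (- 1#)) (R.-‿involutive 1#)) ⟩
    ν 1#                  ≈⟨ ν-1# ⟩
    0∞                    ∎)
    where open ν-Reasoning

  -‿∈𝒪 : ∀ {x} → x ∈𝒪 → (- x) ∈𝒪
  -‿∈𝒪 {x} x∈𝒪 = ∈𝒪-resp-≈ (R.-1*x≈-x x) (*-∈𝒪 -1#∈𝒪 x∈𝒪)

  sum-∈𝒪 : ∀ {n} (f : Fin n → Carrier) → (∀ i → f i ∈𝒪) → sum f ∈𝒪
  sum-∈𝒪 {zero}  f f∈𝒪 = 0#∈𝒪
  sum-∈𝒪 {suc n} f f∈𝒪 = +-∈𝒪 (f∈𝒪 zero) (sum-∈𝒪 (f ∘ suc) (f∈𝒪 ∘ suc))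

  ν≤⇒*inverse∈𝒪 : ∀ {c y z} → c * y ≈ 1# → ν c ≤∞ ν z → (z * y) ∈𝒪
  ν≤⇒*inverse∈𝒪 {c} {y} {z} cy≈1 νc≤νz = begin
    0∞           ≈⟨ ν-1# ⟨
    ν 1#         ≈⟨ ν-cong cy≈1 ⟨
    ν (c * y)    ≈⟨ ν-mult c y ⟩
    ν c +∞ ν y   ≲⟨ +∞-monoˡ-≤∞ {ν c} {ν z} (ν y) νc≤νz ⟩
    ν z +∞ ν y   ≈⟨ ν-mult z y ⟨
    ν (z * y)    ∎
    where open ν-Reasoning

  ≈0#? : ∀ x → Dec (x ≈ 0#)
  ≈0#? x with ν x in νx≡
  ... | ∞     = yes (Equivalence.to (ν-∞ x) (≡.subst (_≈∞ ∞) (≡.sym νx≡) tt))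
  ... | fin _ = no λ x≈0 → Level.lower (≡.subst (_≈∞ ∞) νx≡ (Equivalence.from (ν-∞ x) x≈0))

  -- Take an entry a k of least valuation; a j / a k then lies in 𝒪 (or everything is 0).
  ∃-𝒪-divisor-of-all : ∀ {m} (a : Fin (suc m) → Carrier) →
    ∃ λ k → ∃ λ (γ : Fin (suc m) → Carrier) → (∀ j → γ j ∈𝒪) × (∀ j → a j ≈ γ j * a k)
  ∃-𝒪-divisor-of-all a with argmin ≤∞-totalPreorder (ν ∘ a)
  ... | k , νak≤ with ≈0#? (a k)
  ...   | yes ak≈0 = k , (λ _ → 0#) , (λ _ → 0#∈𝒪) , λ j → trans (aj≈0 j) (sym (zeroˡ (a k)))
    where
    aj≈0 : ∀ j → a j ≈ 0#
    aj≈0 j = Equivalence.to (ν-∞ (a j)) (∞≤∞⇒≈∞ {ν (a j)} (begin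
      ∞        ≈⟨ Equivalence.from (ν-∞ (a k)) ak≈0 ⟨
      ν (a k)  ≲⟨ νak≤ j ⟩
      ν (a j)  ∎))
      where open ν-Reasoning
  ...   | no ak≉0 with IsFieldCR.inverse isField (a k) ak≉0
  ...     | y , ak*y≈1 =
    k , (λ j → a j * y) , (λ j → ν≤⇒*inverse∈𝒪 ak*y≈1 (νak≤ j)) , aj≈aj*y*ak
    where
    aj≈aj*y*ak : ∀ j → a j ≈ a j * y * a k
    aj≈aj*y*ak j = begin
      a j              ≈⟨ *-identityʳ (a j) ⟨
      a j * 1#         ≈⟨ *-congˡ ak*y≈1 ⟨
      a j * (a k * y)  ≈⟨ *-congˡ (*-comm (a k) y) ⟩
      a j * (y * a k)  ≈⟨ *-assoc (a j) y (a k) ⟨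
      a j * y * a k    ∎
      where open SetoidReasoning setoid

module LinearDependence {c ℓ g ℓg ℓ≤} (K : ValuedField c ℓ g ℓg ℓ≤) where
  open ValuedField K hiding (zero)
  open ValuationRing K
  open RingSums cring
  open SemiringSum semiring using (sum)
  private module P = RingProperties ring

  record 𝒪-Dependency {n m} (v : Fin m → Point K n) : Set (c ⊔ ℓ ⊔ ℓ≤) where
    field
      coeff          : Fin m → Carrier
      coeff∈𝒪        : ∀ j → coeff j ∈𝒪
      pivot          : Fin m
      coeff-pivot≈1  : coeff pivot ≈ 1#
      combination≋0  : ∀ t → combination K coeff v t ≈ 0#

  combination-insertAt : ∀ {n m} (v : Fin (suc m) → Point K n) k (γ : Fin (suc m) → Carrier)
    (μ : Fin m → Carrier) t →
    combination K (insertAt μ k (- sum (λ j → μ j * γ (punchIn k j)))) v t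
      ≈ combination K μ (λ j s → v (punchIn k j) s - γ (punchIn k j) * v k s) t
  combination-insertAt v k γ μ t = begin
    combination K (insertAt μ k (- Σμγ)) v t
      ≈⟨ sum-insertAt-* μ (λ j → v j t) k (- Σμγ) ⟩
    - Σμγ * v k t + sum (λ j → μ j * v (punchIn k j) t)
      ≈⟨ +-comm _ _ ⟩
    sum (λ j → μ j * v (punchIn k j) t) + - Σμγ * v k t
      ≈⟨ +-congˡ (P.-‿distribˡ-* Σμγ (v k t)) ⟨
    sum (λ j → μ j * v (punchIn k j) t) - Σμγ * v k t
      ≈⟨ +-congˡ (-‿cong (sum-*-*ʳ μ (γ ∘ punchIn k) (v k t))) ⟨
    sum (λ j → μ j * v (punchIn k j) t) - sum (λ j → μ j * (γ (punchIn k j) * v k t))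
      ≈⟨ sum-*-sub μ (λ j → v (punchIn k j) t) (λ j → γ (punchIn k j) * v k t) ⟨
    combination K μ (λ j s → v (punchIn k j) s - γ (punchIn k j) * v k s) t ∎
    where
    open SetoidReasoning setoid
    Σμγ : Carrier
    Σμγ = sum (λ j → μ j * γ (punchIn k j))

  -- Gaussian elimination over 𝒪: subtract γ j times the vector v k whose first coordinate has least
  -- valuation, so all multipliers γ j lie in 𝒪, and recurse on the other vectors without that coordinate.
  𝒪-dependency : ∀ n m → n ℕ.< m → (v : Fin m → Point K n) → 𝒪-Dependency v
  𝒪-dependency zero (suc m) _ v = record
    { coeff         = λ _ → 1#
    ; coeff∈𝒪       = λ _ → 1#∈𝒪
    ; pivot         = zero
    ; coeff-pivot≈1 = refl
    ; combination≋0 = λ ()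
    }
  𝒪-dependency (suc n) (suc m) (ℕ.s≤s n<m) v with ∃-𝒪-divisor-of-all (λ j → v j zero)
  ... | k , γ , γ∈𝒪 , vj0≈γj*vk0 = record
    { coeff         = insertAt μ k (- Σμγ)
    ; coeff∈𝒪       = insertAt-∀ _∈𝒪 μ k (-‿∈𝒪 (sum-∈𝒪 _ λ j → *-∈𝒪 (μ∈𝒪 j) (γ∈𝒪 (punchIn k j))))
                                 μ∈𝒪
    ; pivot         = punchIn k μ-pivot
    ; coeff-pivot≈1 = trans (reflexive (insertAt-punchIn μ k (- Σμγ) μ-pivot)) μ-pivot≈1
    ; combination≋0 = combination≋0
    }
    where
    w : Fin m → Point K (suc n)
    w j s = v (punchIn k j) s - γ (punchIn k j) * v k s

    w-head≈0 : ∀ j → w j zero ≈ 0#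
    w-head≈0 j = trans (+-congʳ (vj0≈γj*vk0 (punchIn k j))) (-‿inverseʳ _)

    open 𝒪-Dependency (𝒪-dependency n m n<m (λ j s → w j (suc s)))
      renaming (coeff to μ; coeff∈𝒪 to μ∈𝒪; pivot to μ-pivot; coeff-pivot≈1 to μ-pivot≈1;
                combination≋0 to μ-combination≋0)

    Σμγ : Carrier
    Σμγ = sum (λ j → μ j * γ (punchIn k j))

    μw≈0 : ∀ t → combination K μ w t ≈ 0#
    μw≈0 zero    = sum-zero _ λ j → trans (*-congˡ (w-head≈0 j)) (zeroʳ (μ j))
    μw≈0 (suc t) = μ-combination≋0 t

    combination≋0 : ∀ t → combination K (insertAt μ k (- Σμγ)) v t ≈ 0#
    combination≋0 t = trans (combination-insertAt v k γ μ t) (μw≈0 t)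

module Hull {c ℓ g ℓg ℓ≤} (K : ValuedField c ℓ g ℓg ℓ≤) where
  open ValuedField K hiding (zero)
  open ValuationRing K
  open LinearDependence K
  open RingSums cring
  open SemiringSum semiring using (sum; sum-remove; sum-cong-≋; sum-cong-≗; *-distribʳ-sum)
  private module P = RingProperties ring

  _∈Hull_ : ∀ {d n} → Point K d → (Fin n → Point K d) → Set (c ⊔ ℓ ⊔ ℓ≤)
  p ∈Hull x = ∃ λ α → (∀ j → α j ∈𝒪) × sum α ≈ 1# × _≋_ K (combination K α x) p

  convex-∋-∈Hull : ∀ {d n} (X : Subset K d) (x : Fin n → Point K d) {p} → IsConvex K X → 1 ≤ n →
    (∀ j → X ∋ x j) → p ∈Hull x → X ∋ p
  convex-∋-∈Hull X x convex 1≤n x∈X (α , α∈𝒪 , Σα≈1 , αx≋p) =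
    resp X αx≋p (convex _ 1≤n x α x∈X α∈𝒪 Σα≈1)

  -- From an 𝒪-dependency ∑ λ j (p j - q) = 0 with λ i = 1 we get p i = (∑ λ) q - ∑_{j≠i} λ j p j,
  -- whose coefficients lie in 𝒪 and sum to λ i = 1.
  module _ {d} (p : Fin (suc d) → Point K d) (q : Point K d) (D : 𝒪-Dependency (λ j t → p j t - q t)) where
    open 𝒪-Dependency D renaming (coeff to λ′; coeff∈𝒪 to λ∈𝒪; pivot to i; coeff-pivot≈1 to λi≈1;
                                   combination≋0 to λ-combination≋0)
    private
      open SetoidReasoning setoid
      L : Carrier
      L = sum (removeAt λ′ i)

    hullWeights : Fin (suc d) → Carrier
    hullWeights = insertAt (λ j → - λ′ (punchIn i j)) i (sum λ′)

    hullWeights-∈𝒪 : ∀ j → hullWeights j ∈𝒪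
    hullWeights-∈𝒪 = insertAt-∀ _∈𝒪 _ i (sum-∈𝒪 λ′ λ∈𝒪) (λ j → -‿∈𝒪 (λ∈𝒪 (punchIn i j)))

    sum-hullWeights≈1 : sum hullWeights ≈ 1#
    sum-hullWeights≈1 = begin
      sum hullWeights                          ≈⟨ sum-insertAt _ i (sum λ′) ⟩
      sum λ′ + sum (λ j → - λ′ (punchIn i j))
        ≈⟨ +-cong (sum-remove {i = i} λ′) (sum-neg (removeAt λ′ i)) ⟩
      λ′ i + L - L                             ≈⟨ P.//-rightDividesʳ L (λ′ i) ⟩
      λ′ i                                     ≈⟨ λi≈1 ⟩
      1#                                       ∎

    hullWeights-combination : ∀ t → combination K hullWeights (insertAt (removeAt p i) i q) t ≈ p i t
    hullWeights-combination t = begin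
      combination K hullWeights r t
        ≈⟨ sum-insertAt-* _ (λ j → r j t) i (sum λ′) ⟩
      sum λ′ * r i t + sum (λ j → - λ′ (punchIn i j) * r (punchIn i j) t)
        ≡⟨ ≡.cong₂ (λ u v → sum λ′ * u t + v) (insertAt-lookup (removeAt p i) i q)
             (sum-cong-≗ λ j → ≡.cong (λ u → - λ′ (punchIn i j) * u t)
                                      (insertAt-punchIn (removeAt p i) i q j)) ⟩
      sum λ′ * q t + sum (λ j → - λ′ (punchIn i j) * p (punchIn i j) t)
        ≈⟨ +-congˡ (trans (sum-cong-≋ λ j → sym (P.-‿distribˡ-* (λ′ (punchIn i j)) _))
                           (sum-neg (λ j → λ′ (punchIn i j) * p (punchIn i j) t))) ⟩
      sum λ′ * q t - Λ
        ≈⟨ +-congʳ Σλq≈pi+Λ ⟩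
      p i t + Λ - Λ
        ≈⟨ P.//-rightDividesʳ Λ (p i t) ⟩
      p i t ∎
      where
      r : Fin (suc d) → Point K d
      r = insertAt (removeAt p i) i q
      Λ : Carrier
      Λ = sum (λ j → λ′ (punchIn i j) * p (punchIn i j) t)
      Σλp-Σλq≈0 : sum (λ j → λ′ j * p j t) - sum (λ j → λ′ j * q t) ≈ 0#
      Σλp-Σλq≈0 = trans (sym (sum-*-sub λ′ (λ j → p j t) (λ _ → q t))) (λ-combination≋0 t)
      Σλq≈pi+Λ : sum λ′ * q t ≈ p i t + Λ
      Σλq≈pi+Λ = begin
        sum λ′ * q t                ≈⟨ *-distribʳ-sum (q t) λ′ ⟩
        sum (λ j → λ′ j * q t)      ≈⟨ P.x∙y⁻¹≈ε⇒x≈y _ _ Σλp-Σλq≈0 ⟨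
        sum (λ j → λ′ j * p j t)    ≈⟨ sum-remove {i = i} (λ j → λ′ j * p j t) ⟩
        λ′ i * p i t + Λ            ≈⟨ +-congʳ (trans (*-congʳ λi≈1) (*-identityˡ (p i t))) ⟩
        p i t + Λ                   ∎

  ∃-∈Hull-replaced : ∀ {d} (p : Fin (suc d) → Point K d) (q : Point K d) →
    ∃ λ i → p i ∈Hull insertAt (removeAt p i) i q
  ∃-∈Hull-replaced {d} p q =
    𝒪-Dependency.pivot D , hullWeights p q D , hullWeights-∈𝒪 p q D , sum-hullWeights≈1 p q D ,
    hullWeights-combination p q D
    where
    D : 𝒪-Dependency (λ j t → p j t - q t)
    D = 𝒪-dependency d (suc d) (n<1+n d) (λ j t → p j t - q t)

module ConvexAtoms {c ℓ g ℓg ℓ≤} (K : ValuedField c ℓ g ℓg ℓ≤) where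
  open ValuedField K hiding (zero)
  open RingSums cring using (sum-zero)
  open Hull K

  coordinateHyperplane : ∀ d → Fin d → Subset K d
  coordinateHyperplane d i = record
    { _∋_  = λ x → Level.Lift (SubsetLevel K) (x i ≈ 0#)
    ; resp = λ x≋y (Level.lift xi≈0) → Level.lift (trans (sym (x≋y i)) xi≈0)
    }

  coordinateHyperplane-convex : ∀ d i → IsConvex K (coordinateHyperplane d i)
  coordinateHyperplane-convex d i n _ x α x∈H _ _ =
    Level.lift (sum-zero _ λ j → trans (*-congˡ (Level.lower (x∈H j))) (zeroʳ (α j)))

  coordinateHyperplane-atoms : ∀ d → AllAtomsNonempty K (coordinateHyperplane d)
  coordinateHyperplane-atoms d I = x , atom
    where
    x : Point K d
    x j = if I j then 0# else 1#
    atom : ∀ i → (I i ≡ true → coordinateHyperplane d i ∋ x) ×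
                 (¬ (I i ≡ true) → ¬ (coordinateHyperplane d i ∋ x))
    atom i with I i
    ... | true  = (λ _ → Level.lift refl) , (λ Ii≢true → ⊥-elim (Ii≢true ≡.refl))
    ... | false = (λ ()) , (λ _ 1≈0 → IsFieldCR.1≉0 isField (Level.lower 1≈0))

  allBut : ∀ {k} → Fin k → Fin k → Bool
  allBut i l = not (does (l Fin.≟ i))

  allBut-≢ : ∀ {k} {i l : Fin k} → l ≢ i → allBut i l ≡ true
  allBut-≢ {i = i} {l} l≢i = ≡.cong not (dec-false (l Fin.≟ i) l≢i)

  allBut-self : ∀ {k} (i : Fin k) → ¬ (allBut i i ≡ true)
  allBut-self i allBut-i≡true
    with () ← ≡.trans (≡.sym (≡.cong not (dec-true (i Fin.≟ i) ≡.refl))) allBut-i≡true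

  convex-¬AllAtomsNonempty : ∀ {d k} → d ℕ.< k → (S : Fin k → Subset K d) → (∀ l → IsConvex K (S l)) →
    ¬ AllAtomsNonempty K S
  convex-¬AllAtomsNonempty {d} {k} d<k S convex atoms =
    let i , pi∈Hull = ∃-∈Hull-replaced p q
    in p∉S i (convex-∋-∈Hull (S (inj i)) (insertAt (removeAt p i) i q) (convex (inj i)) (ℕ.s≤s ℕ.z≤n)
                             (replaced∈S i) pi∈Hull)
    where
    inj : Fin (suc d) → Fin k
    inj j = inject≤ j d<k

    q : Point K d
    q = proj₁ (atoms λ _ → true)

    p : Fin (suc d) → Point K d
    p j = proj₁ (atoms (allBut (inj j)))

    q∈S : ∀ l → S l ∋ q
    q∈S l = proj₁ (proj₂ (atoms λ _ → true) l) ≡.refl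

    p∈S : ∀ j {l} → l ≢ inj j → S l ∋ p j
    p∈S j {l} l≢inj-j = proj₁ (proj₂ (atoms (allBut (inj j))) l) (allBut-≢ l≢inj-j)

    p∉S : ∀ j → ¬ (S (inj j) ∋ p j)
    p∉S j = proj₂ (proj₂ (atoms (allBut (inj j))) (inj j)) (allBut-self (inj j))

    replaced∈S : ∀ i l → S (inj i) ∋ insertAt (removeAt p i) i q l
    replaced∈S i = insertAt-∀ (S (inj i) ∋_) (removeAt p i) i (q∈S (inj i))
      λ j → p∈S (punchIn i j) λ inj-i≡ → punchInᵢ≢i i j (inject≤-injective d<k d<k _ _ (≡.sym inj-i≡))

theorem4p10 : ∀ {c ℓ g ℓg ℓ≤ : Level} (K : ValuedField c ℓ g ℓg ℓ≤) (d : ℕ) →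
    1 ≤ d → ConvHasDualVCDim K d d
theorem4p10 K d _ =
  (coordinateHyperplane d , coordinateHyperplane-convex d , coordinateHyperplane-atoms d) ,
  λ k d<k → convex-¬AllAtomsNonempty d<k
  where open ConvexAtoms K
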